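{- Let $\mathcal{B}_{b,t}$ and $\mathcal{B}_{b',t'}$ be two blossoms such that $b\in\mathcal{B}_{b',t'}$. Then $\mathcal{B}_{b,t}\subsetneq\mathcal{B}_{b',t'}$.
   Context: $G=(V,E)$ is a finite undirected graph with a matching $M$, with at least one unmatched vertex. Alternating paths are simple paths alternating between unmatched edges (not in $M$) and matched edges (in $M$), starting with an unmatched edge when starting at an unmatched vertex. $l_m$ is the minimum length of an augmenting path (alternating path between two distinct unmatched vertices), $\infty$ if none. $\mathrm{evenlevel}(v)$, $\mathrm{oddlevel}(v)$ are the minimum lengths of even, resp. odd, alternating paths from an unmatched vertex to $v$ ($\infty$ if none); such minimum paths are $\mathrm{evenlevel}(v)$, $\mathrm{oddlevel}(v)$ paths. Tenacity $t(v)=\mathrm{evenlevel}(v)+\mathrm{oddlevel}(v)$. A vertex is outer if $\mathrm{evenlevel}(v)<\mathrm{oddlevel}(v)$. For $t(v)=t<l_m$, $\mathrm{base}(v)$ is the vertex of tenacity $>t$ furthest from the starting unmatched vertex along any $\mathrm{evenlevel}(v)$ or $\mathrm{oddlevel}(v)$ path (known to be independent of the path). Blossoms: for an outer vertex $b$ and an odd number $t$ with $t<t(b)$ and $t<l_m$, $\mathcal{B}_{b,1}=\emptyset$, and for $t\ge3$, with $S_{b,t}=\{v: t(v)=t,\ \mathrm{base}(v)=b\}$, $\mathcal{B}_{b,t}=S_{b,t}\cup\bigcup_{v\in S_{b,t}\cup\{b\},\ v\text{ outer}}\mathcal{B}_{v,t-2}$. -}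

module Defs where

open import Data.Nat using (ℕ; zero; suc; _+_; _<_; _≤_)
open import Data.Bool using (Bool; true; false; not; if_then_else_)
open import Data.Fin using (Fin)
open import Data.List using (List; []; _∷_; _++_; length)
open import Data.List.Relation.Unary.All using (All)
open import Data.List.Relation.Unary.Unique.Propositional using (Unique)
open import Data.Product using (Σ; ∃; ∃-syntax; _×_; _,_)
open import Data.Sum using (_⊎_)
open import Data.Empty using (⊥)
open import Data.Unit using (⊤)
open import Relation.Nullary using (¬_)
open import Relation.Binary.PropositionalEquality using (_≡_; _≢_)

isEven : ℕ → Bool
isEven zero = true
isEven (suc n) = not (isEven n)

Odd : ℕ → Set
Odd n = isEven n ≡ false

data ℕ∞ : Set where
  fin : ℕ → ℕ∞
  ∞   : ℕ∞

_+∞_ : ℕ∞ → ℕ∞ → ℕ∞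
fin a +∞ fin b = fin (a + b)
fin _ +∞ ∞ = ∞
∞ +∞ _ = ∞

_<∞_ : ℕ∞ → ℕ∞ → Set
fin a <∞ fin b = a < b
fin _ <∞ ∞ = ⊤
∞ <∞ _ = ⊥

record IsGraph {n : ℕ} (E : Fin n → Fin n → Set) : Set where
  field
    sym    : ∀ {u v} → E u v → E v u
    irrefl : ∀ {u} → ¬ E u u

record IsMatching {n : ℕ} (E : Fin n → Fin n → Set) (M : Fin n → Fin n → Set) : Set where
  field
    sub    : ∀ {u v} → M u v → E u v
    sym    : ∀ {u v} → M u v → M v u
    unique : ∀ {u v w} → M u v → M u w → v ≡ w

module Setup {n : ℕ} (E : Fin n → Fin n → Set) (M : Fin n → Fin n → Set) where

  V : Set
  V = Fin n

  Unmatched : V → Set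
  Unmatched v = ¬ (∃[ w ] M v w)

  data AltFrom : Bool → List V → Set where
    one  : ∀ {m} v → AltFrom m (v ∷ [])
    cons : ∀ {m} u v rest → E u v → (if m then M u v else ¬ M u v) →
           AltFrom (not m) (v ∷ rest) → AltFrom m (u ∷ v ∷ rest)

  endOf : V → List V → V
  endOf s [] = s
  endOf s (x ∷ xs) = endOf x xs

  -- the vertex list  s ∷ xs  is a (simple) alternating path starting at the
  -- unmatched vertex s (hence starting with an unmatched edge); its length is  length xs
  IsAltPath : V → List V → Set
  IsAltPath s xs = Unmatched s × Unique (s ∷ xs) × AltFrom false (s ∷ xs)

  Reach : Bool → V → ℕ → Set
  Reach e v k = ∃[ s ] ∃[ xs ] (IsAltPath s xs × endOf s xs ≡ v × length xs ≡ k × isEven k ≡ e)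

  -- Level e v ℓ : ℓ is evenlevel(v) (e ≡ true) resp. oddlevel(v) (e ≡ false)
  Level : Bool → V → ℕ∞ → Set
  Level e v (fin k) = Reach e v k × (∀ k' → Reach e v k' → k ≤ k')
  Level e v ∞ = ∀ k → ¬ Reach e v k

  Tenacity : V → ℕ∞ → Set
  Tenacity v τ = ∃[ ev ] ∃[ od ] (Level true v ev × Level false v od × τ ≡ ev +∞ od)

  TenGt : V → ℕ → Set
  TenGt v t = ∃[ τ ] (Tenacity v τ × fin t <∞ τ)

  Outer : V → Set
  Outer v = ∃[ ev ] ∃[ od ] (Level true v ev × Level false v od × ev <∞ od)

  Augmenting : V → List V → Set
  Augmenting s xs = IsAltPath s xs × Unmatched (endOf s xs) × endOf s xs ≢ s

  Lm : ℕ∞ → Set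
  Lm (fin k) = (∃[ s ] ∃[ xs ] (Augmenting s xs × length xs ≡ k))
             × (∀ s xs → Augmenting s xs → k ≤ length xs)
  Lm ∞ = ∀ s xs → ¬ Augmenting s xs

  LtLm : ℕ → Set
  LtLm t = ∃[ ℓ ] (Lm ℓ × fin t <∞ ℓ)

  -- For t = t(v): along some evenlevel(v) or oddlevel(v)
  -- path, b is the vertex of tenacity > t furthest from the starting unmatched vertex
  -- (i.e. no vertex after b on the path has tenacity > t).
  Base : V → V → Set
  Base v b = ∃[ t ] (Tenacity v (fin t) ×
             ∃[ e ] ∃[ s ] ∃[ xs ] ∃[ pre ] ∃[ post ]
               (IsAltPath s xs × endOf s xs ≡ v × Level e v (fin (length xs)) ×
                s ∷ xs ≡ pre ++ b ∷ post × TenGt b t × All (λ w → ¬ TenGt w t) post))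

  InS : V → ℕ → V → Set
  InS b t v = Tenacity v (fin t) × Base v b

  -- InB b t x : x ∈ 𝓑_{b,t}.  No constructor for index 1, so 𝓑_{b,1} = ∅;
  -- for t + 2 : 𝓑_{b,t+2} = S_{b,t+2} ∪ ⋃_{v ∈ S_{b,t+2} ∪ {b}, v outer} 𝓑_{v,t}.
  data InB : V → ℕ → V → Set where
    inS   : ∀ {b t x} → InS b (suc (suc t)) x → InB b (suc (suc t)) x
    inRec : ∀ {b t v x} → (v ≡ b ⊎ InS b (suc (suc t)) v) → Outer v →
            InB v t x → InB b (suc (suc t)) x

  IsBlossom : V → ℕ → Set
  IsBlossom b t = Outer b × Odd t × TenGt b t × LtLm t

-- Every vertex of a blossom has tenacity at most its index, so the base b of the
-- blossom 𝓑_{b,t} (with t < t(b)) lies outside it; this gives strictness.  For the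
-- inclusion, follow the derivation of b ∈ 𝓑_{b',t'} down to the level T at which b
-- enters as a member of S_{b'',T}.  Then T = t(b) > t, and both are odd, so
-- t ≤ T − 2; since b is outer, 𝓑_{b,t} ⊆ 𝓑_{b,T−2} ⊆ 𝓑_{b'',T}, and the
-- derivation carries this back up to 𝓑_{b',t'}.
module Submission where

open import Defs
open import Data.Nat using (ℕ; zero; suc; _<_; _≤_; z≤n; s≤s)
open import Data.Nat.Properties using (≤-antisym; ≤-refl; ≤-trans; n≤1+n; ≤-pred; <-irrefl; <-≤-trans; m≤n⇒m<n∨m≡n)
open import Data.Bool.Properties using (not-involutive; not-injective)
open import Data.Fin using (Fin)
open import Data.Product using (∃-syntax; _×_; _,_)
open import Data.Sum using (inj₁; inj₂)
open import Data.Empty using (⊥-elim)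
open import Relation.Nullary using (¬_)
open import Relation.Binary.PropositionalEquality using (_≡_; refl; sym; trans; cong; subst)

isEven-2+ : ∀ n → isEven (suc (suc n)) ≡ isEven n
isEven-2+ n = not-involutive (isEven n)

<∧sameParity⇒2+≤ : ∀ {m n} → m < n → isEven m ≡ isEven n → suc (suc m) ≤ n
<∧sameParity⇒2+≤ {zero}  {suc zero}    _         ()
<∧sameParity⇒2+≤ {zero}  {suc (suc n)} _         _ = s≤s (s≤s z≤n)
<∧sameParity⇒2+≤ {suc m} {suc n}       (s≤s m<n) p = s≤s (<∧sameParity⇒2+≤ m<n (not-injective p))

module _ {n : ℕ} (E M : Fin n → Fin n → Set) where
  open Setup E M

  level-unique : ∀ {e v ℓ ℓ'} → Level e v ℓ → Level e v ℓ' → ℓ ≡ ℓ'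
  level-unique {ℓ = fin k} {fin k'} (r , min) (r' , min') = cong fin (≤-antisym (min k' r') (min' k r))
  level-unique {ℓ = fin k} {∞}      (r , _)   none       = ⊥-elim (none k r)
  level-unique {ℓ = ∞}     {fin k'} none      (r' , _)   = ⊥-elim (none k' r')
  level-unique {ℓ = ∞}     {∞}      _         _          = refl

  tenacity-unique : ∀ {v τ τ'} → Tenacity v τ → Tenacity v τ' → τ ≡ τ'
  tenacity-unique (_ , _ , le , lo , τ≡) (_ , _ , le' , lo' , τ'≡)
    rewrite level-unique le le' | level-unique lo lo' = trans τ≡ (sym τ'≡)

  InB⇒tenacity≤ : ∀ {b t x} → InB b t x → ∃[ τ ] (Tenacity x (fin τ) × τ ≤ t)
  InB⇒tenacity≤ {t = t} (inS (te , _)) = t , te , ≤-refl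
  InB⇒tenacity≤ (inRec _ _ x∈B) with InB⇒tenacity≤ x∈B
  ... | τ , te , τ≤ = τ , te , ≤-trans τ≤ (≤-trans (n≤1+n _) (n≤1+n _))

  ¬InB-base : ∀ {b t} → TenGt b t → ¬ InB b t b
  ¬InB-base (τ , te , t<τ) b∈B with InB⇒tenacity≤ b∈B
  ... | τ' , te' , τ'≤t with tenacity-unique te te'
  ... | refl = <-irrefl refl (<-≤-trans t<τ τ'≤t)

  -- 𝓑_{b,t} ⊆ 𝓑_{b,t+2} holds because b is outer: take v = b in the union.
  InB-raise : ∀ {b t T x} → Outer b → t ≤ T → isEven t ≡ isEven T → InB b t x → InB b T x
  InB-raise ob t≤T p x∈B with m≤n⇒m<n∨m≡n t≤T
  ... | inj₂ refl = x∈B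
  ... | inj₁ t<T with <∧sameParity⇒2+≤ t<T p
  ... | s≤s (s≤s {n = T₀} t≤T₀) =
    inRec (inj₁ refl) ob (InB-raise ob t≤T₀ (trans p (isEven-2+ T₀)) x∈B)

  InB-base⇒⊆ : ∀ {b' T b t} → InB b' T b → Odd T → Outer b → Odd t → TenGt b t →
               ∀ x → InB b t x → InB b' T x
  InB-base⇒⊆ {T = suc (suc T₀)} {b} {t} (inS b∈S@(te , _)) oddT ob oddt (τ , te' , t<τ) x x∈B =
    inRec (inj₂ b∈S) ob (InB-raise ob (≤-pred (≤-pred t+2≤T)) (trans sameParity (isEven-2+ T₀)) x∈B)
    where
      sameParity : isEven t ≡ isEven (suc (suc T₀))
      sameParity = trans oddt (sym oddT)
      t<T : t < suc (suc T₀)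
      t<T = subst (fin t <∞_) (tenacity-unique te' te) t<τ
      t+2≤T : suc (suc t) ≤ suc (suc T₀)
      t+2≤T = <∧sameParity⇒2+≤ t<T sameParity
  InB-base⇒⊆ {T = suc (suc T₀)} (inRec via ov b∈B) oddT ob oddt tb x x∈B =
    inRec via ov (InB-base⇒⊆ b∈B (trans (sym (isEven-2+ T₀)) oddT) ob oddt tb x x∈B)

lemma10 : ∀ {n : ℕ} (E M : Fin n → Fin n → Set) → IsGraph E → IsMatching E M →
    (∃[ u ] Setup.Unmatched E M u) →
    ∀ (b b' : Fin n) (t t' : ℕ) →
    Setup.IsBlossom E M b t → Setup.IsBlossom E M b' t' →
    Setup.InB E M b' t' b →
    (∀ x → Setup.InB E M b t x → Setup.InB E M b' t' x) ×
    (∃[ x ] (Setup.InB E M b' t' x × ¬ Setup.InB E M b t x))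
lemma10 E M _ _ _ b b' t t' (ob , oddt , t<t[b] , _) (_ , oddt' , _ , _) b∈B' =
  InB-base⇒⊆ E M b∈B' oddt' ob oddt t<t[b] , b , b∈B' , ¬InB-base E M t<t[b]
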